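{- Let $A$ be a finite or countable alphabet with $|A|\ge 2$, let $\theta$ be a literal (anti)morphism onto $A^*$, and let $y\in A^*$ with $|y|\ge 2$ whose initial letter $a$ and terminal letter $\overline a$ are different, i.e. $y=ax\overline a$ with $a\ne\overline a$. Set $z=\overline a^{\,|y|}\,y\,a^{|y|}$. Let $u,v\in A^+$ and $i,j\in\mathbb{Z}$ be such that $|u|\le |z|-1$ and $\theta^i(z)v=u\theta^j(z)$. Then $|u|=|v|\ge 2|y|$, and there exist a letter $b$ and a unique positive integer $k\le |y|$ (depending on $|u|$) such that $\theta^i(z)=ub^k$ and $\theta^j(z)=b^kv$.
   Context: $A^*$ is the free monoid over $A$, $A^+=A^*\setminus\{\varepsilon\}$, $|w|$ is the length of $w$. Standing assumption: $\theta:A^*\to A^*$ is a bijection, literal ($\theta(A)\subseteq A$), and either a morphism or an antimorphism ($\theta(\varepsilon)=\varepsilon$, $\theta(xy)=\theta(y)\theta(x)$); $\theta^i$ for $i\in\mathbb{Z}$ denotes the $i$-th iterate (with $\theta^{ -1}$ the inverse). -}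

module Defs where

open import Data.Nat using (ℕ; zero; suc)
open import Data.Integer using (ℤ; +_; -[1+_])
open import Data.List using (List; []; _∷_; _++_; [_])
open import Data.Product using (∃; _×_)
open import Function using (_∘_; id)
open import Function.Bundles using (_↔_; Inverse)
open import Relation.Binary.PropositionalEquality using (_≡_)

IsLiteral : {A : Set} → (List A ↔ List A) → Set
IsLiteral {A} θ = ∀ (c : A) → ∃ λ (d : A) → Inverse.to θ [ c ] ≡ [ d ]

IsMorphism : {A : Set} → (List A ↔ List A) → Set
IsMorphism {A} θ = ∀ (x y : List A) → Inverse.to θ (x ++ y) ≡ Inverse.to θ x ++ Inverse.to θ y

IsAntimorphism : {A : Set} → (List A ↔ List A) → Set
IsAntimorphism {A} θ =
  (Inverse.to θ [] ≡ []) × (∀ (x y : List A) → Inverse.to θ (x ++ y) ≡ Inverse.to θ y ++ Inverse.to θ x)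

iter : {X : Set} → ℕ → (X → X) → X → X
iter zero    f = id
iter (suc n) f = f ∘ iter n f

pow : {A : Set} → (List A ↔ List A) → ℤ → List A → List A
pow θ (+ n)      = iter n (Inverse.to θ)
pow θ -[1+ n ]   = iter (suc n) (Inverse.from θ)

module Submission where

-- Every power θⁱ acts letter by letter through an injective map on A, possibly followed by
-- reversal, so with n = |y| it sends z = āⁿ a x ā aⁿ to a word pⁿ q X p qⁿ with p ≠ q.
-- If θⁱ(z) v = u θʲ(z) with 0 < |u| < 3n, write θⁱ(z) = u t and θʲ(z) = t v. Were |t| > n,
-- the prefix rⁿ of θʲ(z) would occur strictly inside pⁿ q X p qⁿ, but every such occurrence
-- contains both a p and a q. Hence |t| ≤ n, and as a short suffix of θⁱ(z), t is a power of q.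

open import Defs
open import Data.Nat using (ℕ; zero; suc; _+_; _*_; _∸_; _≤_; _<_; s≤s; z≤n; _<?_; _≤?_)
open import Data.Nat.Properties
open import Data.Integer using (ℤ; -[1+_]) renaming (+_ to +ℤ_)
open import Data.List using (List; []; _∷_; _++_; [_]; length; replicate; map; reverse)
open import Data.List.Properties
open import Data.List.Relation.Unary.All as All using (All)
import Data.List.Relation.Unary.All.Properties as All
open import Data.Product using (Σ; ∃; ∃₂; _×_; _,_; proj₁; proj₂; swap)
open import Data.Sum as Sum using (_⊎_; inj₁; inj₂)
open import Data.Empty using (⊥-elim)
open import Function using (_∘_; id)
open import Function.Bundles using (_↔_; Inverse)
open import Function.Definitions using (Injective)
open import Relation.Nullary using (yes; no)
open import Relation.Binary.PropositionalEquality
  using (_≡_; _≢_; refl; sym; trans; cong; cong₂; subst; subst₂; _≗_; module ≡-Reasoning)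

private
  variable
    A B : Set
    f h : List A → List A
    c p q r : A
    k m n : ℕ
    s u v w W X ys ws : List A

ActsLetterwiseBy : (A → A) → (List A → List A) → Set
ActsLetterwiseBy g f = f ≗ map g ⊎ f ≗ reverse ∘ map g

Letterwise : (List A → List A) → Set
Letterwise {A} f = ∃ λ (g : A → A) → Injective _≡_ _≡_ g × ActsLetterwiseBy g f

letterwise-length : Letterwise f → ∀ w → length (f w) ≡ length w
letterwise-length (g , _ , inj₁ f≗) w = trans (cong length (f≗ w)) (length-map g w)
letterwise-length (g , _ , inj₂ f≗) w =
  trans (cong length (f≗ w)) (trans (length-reverse (map g w)) (length-map g w))

letterwise-id : Letterwise {A} id
letterwise-id = id , id , inj₁ (sym ∘ map-id)

letterwise-∘ : Letterwise f → Letterwise h → Letterwise (f ∘ h)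
letterwise-∘ {f = f} {h = h} (g , g-inj , f≗) (g′ , g′-inj , h≗) =
  g ∘ g′ , g′-inj ∘ g-inj , orientation f≗ h≗
  where
  map² : ∀ w → map g (map g′ w) ≡ map (g ∘ g′) w
  map² w = sym (map-∘ w)
  orientation : ActsLetterwiseBy g f → ActsLetterwiseBy g′ h
              → ActsLetterwiseBy (g ∘ g′) (f ∘ h)
  orientation (inj₁ F) (inj₁ H) = inj₁ λ w →
    trans (F (h w)) (trans (cong (map g) (H w)) (map² w))
  orientation (inj₁ F) (inj₂ H) = inj₂ λ w →
    trans (F (h w)) (trans (cong (map g) (H w))
      (trans (reverse-map g (map g′ w)) (cong reverse (map² w))))
  orientation (inj₂ F) (inj₁ H) = inj₂ λ w →
    trans (F (h w)) (cong reverse (trans (cong (map g) (H w)) (map² w)))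
  orientation (inj₂ F) (inj₂ H) = inj₁ λ w →
    trans (F (h w)) (trans (cong (reverse ∘ map g) (H w))
      (trans (cong reverse (reverse-map g (map g′ w)))
        (trans (reverse-involutive _) (map² w))))

letterwise-iter : Letterwise f → ∀ n → Letterwise (iter n f)
letterwise-iter lw zero    = letterwise-id
letterwise-iter lw (suc n) = letterwise-∘ lw (letterwise-iter lw n)

IsLetterToLetter : (List A → List A) → Set
IsLetterToLetter {A} f = ∀ (c : A) → ∃ λ d → f [ c ] ≡ [ d ]

IsMorphic : (List A → List A) → Set
IsMorphic f = ∀ x y → f (x ++ y) ≡ f x ++ f y

IsAntimorphic : (List A → List A) → Set
IsAntimorphic f = f [] ≡ [] × (∀ x y → f (x ++ y) ≡ f y ++ f x)

-- A morphism fixes [] automatically, since f [] is an idempotent of the free monoid.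
letterToLetter-letterwise : {f : List A → List A} → IsLetterToLetter f → Injective _≡_ _≡_ f
                          → IsMorphic f ⊎ IsAntimorphic f → Letterwise f
letterToLetter-letterwise {A = A} {f = f} letter f-inj hom = g , g-inj , acts hom
  where
  g : A → A
  g = proj₁ ∘ letter
  g-inj : Injective _≡_ _≡_ g
  g-inj {c} {d} e = ∷-injectiveˡ (f-inj (trans (proj₂ (letter c))
                                        (trans (cong [_] e) (sym (proj₂ (letter d))))))
  acts : IsMorphic f ⊎ IsAntimorphic f → ActsLetterwiseBy g f
  acts (inj₁ f-mor) = inj₁ go
    where
    go : f ≗ map g
    go []      = ++-identityʳ-unique (f []) (f-mor [] [])
    go (c ∷ w) = trans (f-mor [ c ] w) (cong₂ _++_ (proj₂ (letter c)) (go w))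
  acts (inj₂ (f[]≡[] , f-anti)) = inj₂ go
    where
    go : f ≗ reverse ∘ map g
    go []      = f[]≡[]
    go (c ∷ w) = trans (f-anti [ c ] w)
      (trans (cong₂ _++_ (go w) (proj₂ (letter c))) (sym (unfold-reverse (g c) (map g w))))

length≡1⇒singleton : length w ≡ 1 → ∃ λ d → w ≡ [ d ]
length≡1⇒singleton {w = d ∷ []} _ = d , refl

module _ {f h : List A → List A} (f-h : ∀ w → f (h w) ≡ w) (h-f : ∀ w → h (f w) ≡ w) where

  inverse-injective : Injective _≡_ _≡_ h
  inverse-injective {x} {y} e = trans (sym (f-h x)) (trans (cong f e) (f-h y))

  inverse-letterToLetter : Letterwise f → IsLetterToLetter h
  inverse-letterToLetter lw c = length≡1⇒singleton
    (trans (sym (letterwise-length lw (h [ c ]))) (cong length (f-h [ c ])))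

  inverse-morphic : IsMorphic f → IsMorphic h
  inverse-morphic f-mor x y = begin
    h (x ++ y)             ≡⟨ cong h (cong₂ _++_ (f-h x) (f-h y)) ⟨
    h (f (h x) ++ f (h y)) ≡⟨ cong h (f-mor (h x) (h y)) ⟨
    h (f (h x ++ h y))     ≡⟨ h-f _ ⟩
    h x ++ h y             ∎
    where open ≡-Reasoning

  inverse-antimorphic : IsAntimorphic f → IsAntimorphic h
  inverse-antimorphic (f[]≡[] , f-anti) = trans (cong h (sym f[]≡[])) (h-f []) , λ x y → begin
    h (x ++ y)             ≡⟨ cong h (cong₂ _++_ (f-h x) (f-h y)) ⟨
    h (f (h x) ++ f (h y)) ≡⟨ cong h (f-anti (h y) (h x)) ⟨
    h (f (h y ++ h x))     ≡⟨ h-f _ ⟩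
    h y ++ h x             ∎
    where open ≡-Reasoning

bijection-letterwise : (θ : List A ↔ List A) → IsLiteral θ → IsMorphism θ ⊎ IsAntimorphism θ
                     → Letterwise (Inverse.to θ) × Letterwise (Inverse.from θ)
bijection-letterwise θ literal hom = to-letterwise , from-letterwise
  where
  open Inverse θ
  to-letterwise : Letterwise to
  to-letterwise = letterToLetter-letterwise literal
    (inverse-injective strictlyInverseʳ strictlyInverseˡ) hom
  from-hom : IsMorphic from ⊎ IsAntimorphic from
  from-hom = Sum.map (inverse-morphic {f = to} strictlyInverseˡ strictlyInverseʳ)
                     (inverse-antimorphic {f = to} strictlyInverseˡ strictlyInverseʳ) hom
  from-letterwise : Letterwise from
  from-letterwise = letterToLetter-letterwise
    (inverse-letterToLetter strictlyInverseˡ strictlyInverseʳ to-letterwise)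
    (inverse-injective strictlyInverseˡ strictlyInverseʳ) from-hom

pow-letterwise : (θ : List A ↔ List A) → IsLiteral θ → IsMorphism θ ⊎ IsAntimorphism θ
               → ∀ i → Letterwise (pow θ i)
pow-letterwise θ literal hom (+ℤ n)   =
  letterwise-iter (proj₁ (bijection-letterwise θ literal hom)) n
pow-letterwise θ literal hom -[1+ n ] =
  letterwise-iter (proj₂ (bijection-letterwise θ literal hom)) (suc n)

-- The word z of the theorem is bordered |y| ā a x.
bordered : ℕ → A → A → List A → List A
bordered n p q X = replicate n p ++ (q ∷ X ++ [ p ]) ++ replicate n q

length-bordered : ∀ n (p q : A) X →
                  length (bordered n p q X) ≡ n + (length (q ∷ X ++ [ p ]) + n)
length-bordered n p q X = trans (length-++ (replicate n p))
  (cong₂ _+_ (length-replicate n)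
             (trans (length-++ (q ∷ X ++ [ p ]))
                    (cong (length (q ∷ X ++ [ p ]) +_) (length-replicate n))))

map-bordered : ∀ (g : A → B) n p q X →
               map g (bordered n p q X) ≡ bordered n (g p) (g q) (map g X)
map-bordered g n p q X = begin
  map g (replicate n p ++ (q ∷ X ++ [ p ]) ++ replicate n q)
    ≡⟨ map-++ g (replicate n p) _ ⟩
  map g (replicate n p) ++ map g ((q ∷ X ++ [ p ]) ++ replicate n q)
    ≡⟨ cong₂ _++_ (map-replicate g n p) (map-++ g (q ∷ X ++ [ p ]) (replicate n q)) ⟩
  replicate n (g p) ++ map g (q ∷ X ++ [ p ]) ++ map g (replicate n q)
    ≡⟨ cong (replicate n (g p) ++_)
            (cong₂ _++_ (cong (g q ∷_) (map-++ g X [ p ])) (map-replicate g n q)) ⟩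
  bordered n (g p) (g q) (map g X) ∎
  where open ≡-Reasoning

reverse-replicate : ∀ n (c : A) → reverse (replicate n c) ≡ replicate n c
reverse-replicate zero    c = refl
reverse-replicate (suc n) c = begin
  reverse (c ∷ replicate n c) ≡⟨ unfold-reverse c (replicate n c) ⟩
  reverse (replicate n c) ++ [ c ] ≡⟨ cong (_++ [ c ]) (reverse-replicate n c) ⟩
  replicate n c ++ [ c ] ≡⟨ snoc n ⟩
  c ∷ replicate n c ∎
  where
  open ≡-Reasoning
  snoc : ∀ n → replicate n c ++ [ c ] ≡ c ∷ replicate n c
  snoc zero    = refl
  snoc (suc n) = cong (c ∷_) (snoc n)

reverse-bordered : ∀ n (p q : A) X →
                   reverse (bordered n p q X) ≡ bordered n q p (reverse X)
reverse-bordered n p q X = begin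
  reverse (P ++ (q ∷ X ++ [ p ]) ++ Q)
    ≡⟨ reverse-++ P _ ⟩
  reverse ((q ∷ X ++ [ p ]) ++ Q) ++ reverse P
    ≡⟨ cong (_++ reverse P) (reverse-++ (q ∷ X ++ [ p ]) Q) ⟩
  (reverse Q ++ reverse (q ∷ X ++ [ p ])) ++ reverse P
    ≡⟨ ++-assoc (reverse Q) _ _ ⟩
  reverse Q ++ reverse (q ∷ X ++ [ p ]) ++ reverse P
    ≡⟨ cong₂ _++_ (reverse-replicate n q) (cong₂ _++_ middle (reverse-replicate n p)) ⟩
  bordered n q p (reverse X) ∎
  where
  open ≡-Reasoning
  P = replicate n p
  Q = replicate n q
  middle : reverse (q ∷ X ++ [ p ]) ≡ p ∷ reverse X ++ [ q ]
  middle = trans (unfold-reverse q (X ++ [ p ])) (cong (_++ [ q ]) (reverse-++ X [ p ]))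

letterwise-bordered : Letterwise f → p ≢ q →
  ∃₂ λ p′ q′ → ∃ λ X′ → p′ ≢ q′ × length X′ ≡ length X
                        × f (bordered n p q X) ≡ bordered n p′ q′ X′
letterwise-bordered {p = p} {q = q} {X = X} {n = n} (g , g-inj , inj₁ f≗) p≢q =
  g p , g q , map g X , p≢q ∘ g-inj , length-map g X ,
  trans (f≗ _) (map-bordered g n p q X)
letterwise-bordered {p = p} {q = q} {X = X} {n = n} (g , g-inj , inj₂ f≗) p≢q =
  g q , g p , reverse (map g X) , p≢q ∘ sym ∘ g-inj ,
  trans (length-reverse (map g X)) (length-map g X) ,
  trans (f≗ _) (trans (cong reverse (map-bordered g n p q X))
                      (reverse-bordered n (g p) (g q) (map g X)))

++-overlap : ∀ (Z : List A) → Z ++ v ≡ u ++ W → length u ≤ length Z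
           → ∃ λ t → Z ≡ u ++ t × W ≡ t ++ v
++-overlap {u = []} Z Zv≡W _ = Z , refl , sym Zv≡W
++-overlap {u = d ∷ u} (c ∷ Z) e (s≤s |u|≤|Z|)
  with t , Z≡ut , W≡tv ← ++-overlap Z (∷-injectiveʳ e) |u|≤|Z|
  = t , cong₂ _∷_ (∷-injectiveˡ e) Z≡ut , W≡tv

++-injective : ∀ (xs us : List A) → xs ++ ys ≡ us ++ ws → length xs ≡ length us
             → xs ≡ us × ys ≡ ws
++-injective []       []       e _ = refl , e
++-injective (x ∷ xs) (y ∷ us) e |xs|≡|us|
  with refl , ys≡ws ← ++-injective xs us (∷-injectiveʳ e) (suc-injective |xs|≡|us|)
  = cong (_∷ xs) (∷-injectiveˡ e) , ys≡ws

suffix-of-replicate : ∀ n (c : A) s t → replicate n c ≡ s ++ t → t ≡ replicate (length t) c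
suffix-of-replicate n       c []      _ refl = cong (λ k → replicate k c) (sym (length-replicate n))
suffix-of-replicate (suc n) c (_ ∷ s) t e = suffix-of-replicate n c s t (∷-injectiveʳ e)

short-suffix-of-++-replicate : ∀ xs n (c : A) u t → xs ++ replicate n c ≡ u ++ t → length t ≤ n
                    → t ≡ replicate (length t) c
short-suffix-of-++-replicate xs n c u t e |t|≤n =
  let s , _ , R≡s++t = ++-overlap u (sym e) |xs|≤|u| in suffix-of-replicate n c s t R≡s++t
  where
  lengths : length xs + n ≡ length u + length t
  lengths = trans (sym (trans (length-++ xs) (cong (length xs +_) (length-replicate n))))
                  (trans (cong length e) (length-++ u))
  |xs|≤|u| : length xs ≤ length u
  |xs|≤|u| = +-cancelʳ-≤ n (length xs) (length u)
    (subst (_≤ length u + n) (sym lengths) (+-monoʳ-≤ (length u) |t|≤n))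

run-across-boundary : u ++ replicate m r ++ w ≡ replicate k p ++ q ∷ s
                    → length u < k → k < length u + m → r ≡ p × r ≡ q
run-across-boundary {u = []}    {k = suc k} e _ k<m = starting-at-0 e k<m
  where
  starting-at-0 : ∀ {m k} → replicate m r ++ w ≡ replicate (suc k) p ++ q ∷ s
                → suc k < m → r ≡ p × r ≡ q
  starting-at-0 {m = suc (suc m)} {k = zero}  e _ =
    ∷-injectiveˡ e , ∷-injectiveˡ (∷-injectiveʳ e)
  starting-at-0 {m = suc m}       {k = suc k} e (s≤s k<m) = starting-at-0 (∷-injectiveʳ e) k<m
run-across-boundary {u = _ ∷ u} {k = suc k} e (s≤s |u|<k) (s≤s k<|u|+m) =
  run-across-boundary {u = u} (∷-injectiveʳ e) |u|<k k<|u|+m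

nonempty-length : u ≢ [] → 0 < length u
nonempty-length {u = []}    u≢[] = ⊥-elim (u≢[] refl)
nonempty-length {u = _ ∷ _} _    = s≤s z≤n

reverse-++-replicate-++ : ∀ u n (r : A) w →
  reverse (u ++ replicate n r ++ w) ≡ reverse w ++ replicate n r ++ reverse u
reverse-++-replicate-++ u n r w = begin
  reverse (u ++ replicate n r ++ w)
    ≡⟨ reverse-++ u _ ⟩
  reverse (replicate n r ++ w) ++ reverse u
    ≡⟨ cong (_++ reverse u) (reverse-++ (replicate n r) w) ⟩
  (reverse w ++ reverse (replicate n r)) ++ reverse u
    ≡⟨ ++-assoc (reverse w) _ _ ⟩
  reverse w ++ reverse (replicate n r) ++ reverse u
    ≡⟨ cong (λ R → reverse w ++ R ++ reverse u) (reverse-replicate n r) ⟩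
  reverse w ++ replicate n r ++ reverse u ∎
  where open ≡-Reasoning

bordered-middle-run : length (q ∷ X ++ [ p ]) ≡ n → length u ≡ n
                    → bordered n p q X ≡ u ++ replicate n r ++ w → r ≡ p × r ≡ q
bordered-middle-run {q = q} {X = X} {p = p} {n = n} {u = u} {r = r} |middle| |u|≡n e =
  All.head (All.++⁻ʳ X (All.tail run)) , All.head run
  where
  R≡middle : replicate n r ≡ q ∷ X ++ [ p ]
  R≡middle = proj₁ (++-injective (replicate n r) (q ∷ X ++ [ p ])
    (proj₂ (++-injective u (replicate n p) (sym e) (trans |u|≡n (sym (length-replicate n)))))
    (trans (length-replicate n) (sym |middle|)))
  run : All (r ≡_) (q ∷ X ++ [ p ])
  run = subst (All (r ≡_)) R≡middle (All.replicate⁺ n refl)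

-- A run rⁿ strictly inside pⁿ q X p qⁿ straddles the boundary pⁿ|q, straddles the boundary
-- p|qⁿ (the first case for the reversed word), or is exactly the middle block q X p.
bordered-inner-run : length (q ∷ X ++ [ p ]) ≡ n → u ≢ [] → w ≢ []
                   → bordered n p q X ≡ u ++ replicate n r ++ w → r ≡ p × r ≡ q
bordered-inner-run {q = q} {X = X} {p = p} {n = n} {u = u} {w = w} {r = r}
                   |middle| u≢[] w≢[] e
  with length u <? n | length w <? n
... | yes |u|<n | _ =
  run-across-boundary {u = u} (sym e) |u|<n (m<n+m n (nonempty-length u≢[]))
... | no _ | yes |w|<n =
  swap (run-across-boundary {u = reverse w} (sym reversed)
         (subst (_< n) (sym (length-reverse w)) |w|<n)
         (m<n+m n (subst (0 <_) (sym (length-reverse w)) (nonempty-length w≢[]))))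
  where
  reversed : bordered n q p (reverse X) ≡ reverse w ++ replicate n r ++ reverse u
  reversed = trans (sym (reverse-bordered n p q X))
                   (trans (cong reverse e) (reverse-++-replicate-++ u n r w))
... | no |u|≮n | no |w|≮n = bordered-middle-run {u = u} |middle| |u|≡n e
  where
  lengths : length u + (n + length w) ≡ n + (n + n)
  lengths = begin
    length u + (n + length w)
      ≡⟨ cong (λ k → length u + (k + length w)) (length-replicate n) ⟨
    length u + (length (replicate n r) + length w)
      ≡⟨ cong (length u +_) (length-++ (replicate n r)) ⟨
    length u + length (replicate n r ++ w)  ≡⟨ length-++ u ⟨
    length (u ++ replicate n r ++ w)        ≡⟨ cong length e ⟨
    length (bordered n p q X)               ≡⟨ length-bordered n p q X ⟩
    n + (length (q ∷ X ++ [ p ]) + n)       ≡⟨ cong (λ k → n + (k + n)) |middle| ⟩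
    n + (n + n)                             ∎
    where open ≡-Reasoning
  |u|≡n : length u ≡ n
  |u|≡n = ≤-antisym
    (+-cancelʳ-≤ (n + n) (length u) n (subst (length u + (n + n) ≤_) lengths
      (+-monoʳ-≤ (length u) (+-monoʳ-≤ n (≮⇒≥ |w|≮n)))))
    (≮⇒≥ |u|≮n)

bordered-overlap : p ≢ q → length (q ∷ X ++ [ p ]) ≡ n
  → bordered n p q X ++ v ≡ u ++ replicate n r ++ W
  → u ≢ [] → length u < length (bordered n p q X)
  → ∃ λ m → 1 ≤ m × m ≤ n × bordered n p q X ≡ u ++ replicate m q
                          × replicate n r ++ W ≡ replicate m q ++ v
bordered-overlap {p = p} {q = q} {X = X} {n = n} {v = v} {u = u} {r = r} {W = W}
                 p≢q |middle| e u≢[] |u|<|Z|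
  with t , Z≡ut , RW≡tv ← ++-overlap (bordered n p q X) e (<⇒≤ |u|<|Z|)
  = length t , 1≤|t| , |t|≤n , trans Z≡ut (cong (u ++_) t≡qᵐ) , trans RW≡tv (cong (_++ v) t≡qᵐ)
  where
  1≤|t| : 1 ≤ length t
  1≤|t| = +-cancelˡ-< (length u) 0 (length t)
    (subst₂ _<_ (sym (+-identityʳ (length u))) (trans (cong length Z≡ut) (length-++ u)) |u|<|Z|)
  |t|≤n : length t ≤ n
  |t|≤n with length t ≤? n
  ... | yes |t|≤n = |t|≤n
  ... | no  |t|≰n = ⊥-elim (p≢q (trans (sym (proj₁ inner)) (proj₂ inner)))
    where
    longer : ∃ λ t′ → t ≡ replicate n r ++ t′ × W ≡ t′ ++ v
    longer = ++-overlap t (sym RW≡tv)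
               (subst (_≤ length t) (sym (length-replicate n)) (<⇒≤ (≰⇒> |t|≰n)))
    t′≢[] : proj₁ longer ≢ []
    t′≢[] t′≡[] = |t|≰n (≤-reflexive (trans (cong length (trans (proj₁ (proj₂ longer))
                    (trans (cong (replicate n r ++_) t′≡[]) (++-identityʳ _)))) (length-replicate n)))
    inner : r ≡ p × r ≡ q
    inner = bordered-inner-run {u = u} |middle| u≢[] t′≢[]
              (trans Z≡ut (cong (u ++_) (proj₁ (proj₂ longer))))
  t≡qᵐ : t ≡ replicate (length t) q
  t≡qᵐ = short-suffix-of-++-replicate (replicate n p ++ q ∷ X ++ [ p ]) n q u t
           (trans (++-assoc (replicate n p) (q ∷ X ++ [ p ]) _) Z≡ut) |t|≤n

length-middle : ∀ (X w : List A) → length X ≡ length w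
              → length (q ∷ X ++ [ p ]) ≡ length (r ∷ w ++ [ c ])
length-middle X w |X|≡|w| =
  cong suc (trans (length-++ X) (trans (cong (_+ 1) |X|≡|w|) (sym (length-++ w))))

length-++-replicate : ∀ u m (c : A) → length (u ++ replicate m c) ≡ length u + m
length-++-replicate u m c = trans (length-++ u) (cong (length u +_) (length-replicate m))

length-++-cancel : ∀ (u t v : List A) → length (u ++ t) ≡ length (t ++ v) → length u ≡ length v
length-++-cancel u t v e = +-cancelʳ-≡ (length t) (length u) (length v) (begin
  length u + length t  ≡⟨ length-++ u ⟨
  length (u ++ t)      ≡⟨ e ⟩
  length (t ++ v)      ≡⟨ length-++-comm t v ⟩
  length (v ++ t)      ≡⟨ length-++ v ⟩
  length v + length t  ∎)
  where open ≡-Reasoning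

length-replicate-injective : replicate k c ≡ replicate m r → k ≡ m
length-replicate-injective {k = k} {m = m} e =
  trans (sym (length-replicate k)) (trans (cong length e) (length-replicate m))

m+k≡n+[n+n]⇒2*n≤m : ∀ m k n → m + k ≡ n + (n + n) → k ≤ n → 2 * n ≤ m
m+k≡n+[n+n]⇒2*n≤m m k n e k≤n = begin
  2 * n   ≡⟨ cong (n +_) (+-identityʳ n) ⟩
  n + n   ≤⟨ +-cancelʳ-≤ k (n + n) m (begin
    n + n + k     ≤⟨ +-monoʳ-≤ (n + n) k≤n ⟩
    n + n + n     ≡⟨ +-assoc n n n ⟩
    n + (n + n)   ≡⟨ e ⟨
    m + k         ∎) ⟩
  m       ∎
  where open ≤-Reasoning

lemma2 : {A : Set} → (enc : A → ℕ) → Injective _≡_ _≡_ enc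
         → (∃₂ λ (c d : A) → c ≢ d)
         → (θ : List A ↔ List A) → IsLiteral θ → (IsMorphism θ ⊎ IsAntimorphism θ)
         → (a ā : A) (x : List A) → a ≢ ā
         → (u v : List A) → u ≢ [] → v ≢ [] → (i j : ℤ)
         → length u ≤ length (replicate (length (a ∷ x ++ [ ā ])) ā ++ (a ∷ x ++ [ ā ]) ++ replicate (length (a ∷ x ++ [ ā ])) a) ∸ 1
         → pow θ i (replicate (length (a ∷ x ++ [ ā ])) ā ++ (a ∷ x ++ [ ā ]) ++ replicate (length (a ∷ x ++ [ ā ])) a) ++ v
           ≡ u ++ pow θ j (replicate (length (a ∷ x ++ [ ā ])) ā ++ (a ∷ x ++ [ ā ]) ++ replicate (length (a ∷ x ++ [ ā ])) a)
         → (length u ≡ length v)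
           × (2 * length (a ∷ x ++ [ ā ]) ≤ length u)
           × (Σ A λ b → Σ ℕ λ k →
               (1 ≤ k × k ≤ length (a ∷ x ++ [ ā ])
                 × pow θ i (replicate (length (a ∷ x ++ [ ā ])) ā ++ (a ∷ x ++ [ ā ]) ++ replicate (length (a ∷ x ++ [ ā ])) a) ≡ u ++ replicate k b
                 × pow θ j (replicate (length (a ∷ x ++ [ ā ])) ā ++ (a ∷ x ++ [ ā ]) ++ replicate (length (a ∷ x ++ [ ā ])) a) ≡ replicate k b ++ v)
               × (∀ (b′ : A) (k′ : ℕ) → 1 ≤ k′ → k′ ≤ length (a ∷ x ++ [ ā ])
                   → pow θ i (replicate (length (a ∷ x ++ [ ā ])) ā ++ (a ∷ x ++ [ ā ]) ++ replicate (length (a ∷ x ++ [ ā ])) a) ≡ u ++ replicate k′ b′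
                   → pow θ j (replicate (length (a ∷ x ++ [ ā ])) ā ++ (a ∷ x ++ [ ā ]) ++ replicate (length (a ∷ x ++ [ ā ])) a) ≡ replicate k′ b′ ++ v
                   → k′ ≡ k))
-- Since |z| is a successor, s≤s turns the
-- bound |u| ≤ |z| ∸ 1 into |u| < |z|.
lemma2 {A} _ _ _ θ literal hom a ā x a≢ā u v u≢[] v≢[] i j |u|≤|z|∸1 eq
  with p , q , X , p≢q , |X|≡|x| , Z₁≡ ← letterwise-bordered {n = length (a ∷ x ++ [ ā ])}
                                           (pow-letterwise θ literal hom i) (a≢ā ∘ sym)
     | _ , _ , _ , _ , _ , Z₂≡ ← letterwise-bordered {n = length (a ∷ x ++ [ ā ])}
                                   (pow-letterwise θ literal hom j) (a≢ā ∘ sym)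
  with m , 1≤m , m≤|y| , Z≡uqᵐ , W≡qᵐv ←
         bordered-overlap {u = u} p≢q (length-middle {q = q} {r = a} X x |X|≡|x|)
           (trans (cong (_++ v) (sym Z₁≡)) (trans eq (cong (u ++_) Z₂≡))) u≢[]
           (subst (length u <_) (trans (sym (letterwise-length (pow-letterwise θ literal hom i) _))
                                       (cong length Z₁≡))
                  (s≤s |u|≤|z|∸1))
  = |u|≡|v| , 2|y|≤|u| , (q , m , (1≤m , m≤|y| , Z₁≡uqᵐ , Z₂≡qᵐv) , unique)
  where
  |y| : ℕ
  |y| = length (a ∷ x ++ [ ā ])
  z : List A
  z = bordered |y| ā a x
  Z₁≡uqᵐ : pow θ i z ≡ u ++ replicate m q
  Z₁≡uqᵐ = trans Z₁≡ Z≡uqᵐ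
  Z₂≡qᵐv : pow θ j z ≡ replicate m q ++ v
  Z₂≡qᵐv = trans Z₂≡ W≡qᵐv
  |powz| : ∀ k → length (pow θ k z) ≡ |y| + (|y| + |y|)
  |powz| k = trans (letterwise-length (pow-letterwise θ literal hom k) z)
                   (length-bordered |y| ā a x)
  |u|≡|v| : length u ≡ length v
  |u|≡|v| = length-++-cancel u (replicate m q) v
    (trans (cong length (sym Z₁≡uqᵐ))
           (trans (|powz| i) (trans (sym (|powz| j)) (cong length Z₂≡qᵐv))))
  2|y|≤|u| : 2 * |y| ≤ length u
  2|y|≤|u| = m+k≡n+[n+n]⇒2*n≤m (length u) m |y|
    (trans (sym (length-++-replicate u m q)) (trans (cong length (sym Z₁≡uqᵐ)) (|powz| i))) m≤|y|
  unique : ∀ b′ k′ → 1 ≤ k′ → k′ ≤ |y| → pow θ i z ≡ u ++ replicate k′ b′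
         → pow θ j z ≡ replicate k′ b′ ++ v → k′ ≡ m
  unique _ _ _ _ Z₁≡uk′ _ =
    length-replicate-injective (++-cancelˡ u _ _ (trans (sym Z₁≡uk′) Z₁≡uqᵐ))
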